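{- Let $B$ be a finite set of species, $T=(V,E)$ a gene tree with leaf set $L$ ($|L|\ge3$), $\sigma:L\to B$ with $\sigma(L)=B$, and $t:V\to\{\bullet,\square,\odot\}$ an event labeling, where $(T,t,\sigma)$ satisfies condition (C). Let $S=(W,H)$ be a species tree with leaf set $B$. If $S$ displays every triple in $\mathfrak{S}(T,t,\sigma)$, then there exists a reconciliation map $\mu$ from $(T,t,\sigma)$ to $S$.
   Context: A phylogenetic tree $T=(V,E)$ on leaf set $L\subseteq V$ is a rooted tree with directed edges, root of indegree zero, and no vertex with indegree one and outdegree one. $x\preceq_T y$ iff $y$ lies on the path from $x$ to the root; $x\prec_T y$ means $x\preceq_T y$, $x\neq y$. $L(x)=\{y\in L:y\preceq_T x\}$. $\operatorname{lca}_T(A)$ is the $\preceq_T$-minimal common ancestor of $A$. An edge from parent $u$ to child $v$ is $[u,v]$; the order extends to edges: for $e=[u,v]$ and vertex $x$, $x\prec e$ iff $x\preceq v$, $e\prec x$ iff $u\preceq x$; for edges $[u,v],[a,b]$, $[u,v]\preceq[a,b]$ iff $v\preceq b$. A species tree $S=(W,H)$ on $B$ is a phylogenetic tree on leaf set $B$ with an extra root vertex $\rho_S$ and extra edge $[\rho_S,\operatorname{lca}_S(B)]$ added. Gene tree data: $T=(V,E)$ phylogenetic tree with leaf set $L$; $\sigma:L\to B$, $\sigma(Y)=\{\sigma(y):y\in Y\}$; $t:V\to\{\bullet,\square,\odot\}$ with $t(x)=\odot$ iff $x\in L$. Condition (C): if $t(z)=\bullet$ and $T',T''$ are subtrees rooted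 at two distinct children of $z$, their leaf sets have disjoint $\sigma$-images. A triple $((x,y),z)$ on three distinct leaves is displayed by a tree $T$ iff $\operatorname{lca}_T(x,y)\prec_T\operatorname{lca}_T(x,y,z)$; $\mathfrak{R}(T)$ is the set of triples displayed by $T$, and $\operatorname{lca}_T(r)=\operatorname{lca}_T(x,y,z)$ for a triple $r$ on $\{x,y,z\}$. $\mathfrak{G}(T,t,\sigma)=\{r\in\mathfrak{R}(T): t(\operatorname{lca}_T(r))=\bullet$ and the three leaves of $r$ have pairwise distinct $\sigma$-images$\}$, and $\mathfrak{S}(T,t,\sigma)=\{((\sigma(x),\sigma(y)),\sigma(z)) : ((x,y),z)\in\mathfrak{G}(T,t,\sigma)\}$, a set of triples on $B$. A reconciliation map from $(T,t,\sigma)$ to $S$ is $\mu:V\to W\cup H$ with, for all $x\in V$: (i) $t(x)=\odot\Rightarrow\mu(x)=\sigma(x)$; (ii) $t(x)=\bullet\Rightarrow\mu(x)\in W\setminus B$; (iii) $t(x)=\square\Rightarrow\mu(x)\in H$; (iv) for $x\prec_T y$: if $t(x)=t(y)=\square$ then $\mu(x)\preceq_S\mu(y)$, otherwise (both $\bullet$ or $t(x)\ne t(y)$) $\mu(x)\prec_S\mu(y)$ in the extended order; (v) $t(x)=\bullet\Rightarrow\mu(x)=\operatorname{lca}_S(\sigma(L(x)))$. -}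

module Defs where

open import Data.Nat using (ℕ; zero; suc)
open import Data.Fin using (Fin)
open import Data.Product using (Σ; ∃; ∃-syntax; _×_; _,_)
open import Data.Sum using (_⊎_)
open import Data.Empty using (⊥)
open import Relation.Nullary using (¬_)
open import Relation.Binary.PropositionalEquality using (_≡_; _≢_)

-- The directed edges are [parent v , v] for every v ≢ root.
-- `reach` (every vertex reaches the root by iterating parent) makes this
-- exactly a rooted tree (acyclic, connected, root of indegree 0).

iter : {A : Set} → (A → A) → ℕ → A → A
iter f zero    a = a
iter f (suc k) a = f (iter f k a)

record RootedTree : Set where
  field
    size        : ℕ
    root        : Fin size
    parent      : Fin size → Fin size
    parent-root : parent root ≡ root
    reach       : ∀ v → ∃[ k ] iter parent k v ≡ root

module _ (T : RootedTree) where
  open RootedTree T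

  Vtx : Set
  Vtx = Fin size

  _⪯_ : Vtx → Vtx → Set
  x ⪯ y = ∃[ k ] iter parent k x ≡ y

  _≺_ : Vtx → Vtx → Set
  x ≺ y = x ⪯ y × x ≢ y

  Child : Vtx → Vtx → Set
  Child v c = c ≢ root × parent c ≡ v

  Leaf : Vtx → Set
  Leaf v = ∀ c → ¬ Child v c

  ExactlyOneChild : Vtx → Set
  ExactlyOneChild v = ∃[ c ] (Child v c × (∀ c′ → Child v c′ → c′ ≡ c))

  IsLCA : (Vtx → Set) → Vtx → Set
  IsLCA A z = (∀ a → A a → a ⪯ z) × (∀ w → (∀ a → A a → a ⪯ w) → z ⪯ w)

  Displays : Vtx → Vtx → Vtx → Set
  Displays x y z =
    Leaf x × Leaf y × Leaf z × x ≢ y × x ≢ z × y ≢ z ×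
    ∃[ u ] ∃[ v ] ( IsLCA (λ a → a ≡ x ⊎ a ≡ y) u
                  × IsLCA (λ a → a ≡ x ⊎ a ≡ y ⊎ a ≡ z) v
                  × u ≺ v )

  -- positions in W ∪ H : a vertex w, or the edge [parent v , v] (v ≢ root)
  data Pos : Set where
    vtx : Vtx → Pos
    edg : Vtx → Pos

  _⪯ᴾ_ : Pos → Pos → Set
  vtx x ⪯ᴾ vtx y = x ⪯ y
  vtx x ⪯ᴾ edg v = x ⪯ v
  edg v ⪯ᴾ vtx x = parent v ⪯ x
  edg v ⪯ᴾ edg b = v ⪯ b

  _≺ᴾ_ : Pos → Pos → Set
  vtx x ≺ᴾ vtx y = x ≺ y
  vtx x ≺ᴾ edg v = x ⪯ v
  edg v ≺ᴾ vtx x = parent v ⪯ x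
  edg v ≺ᴾ edg b = v ≺ b

-- Phylogenetic tree: no vertex of indegree one and outdegree one, and
-- (READING) the root does not have outdegree one either.
IsPhylogenetic : RootedTree → Set
IsPhylogenetic T = ∀ v → ¬ ExactlyOneChild T v

-- Species tree on B = Fin m: a phylogenetic tree on B with an extra root
-- ρ_S and an extra edge [ρ_S , lca(B)].  Equivalently: the root has exactly
-- one child and every other vertex does not have outdegree one; the leaves
-- are identified with B via an injective map `leafOf` onto the leaf set.
record SpeciesTree (m : ℕ) : Set where
  field
    tree       : RootedTree
  open RootedTree tree
  field
    rootOneChild : ExactlyOneChild tree root
    nonRootPhylo : ∀ v → v ≢ root → ¬ ExactlyOneChild tree v
    leafOf       : Fin m → Fin size
    leafOf-inj   : ∀ a b → leafOf a ≡ leafOf b → a ≡ b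
    leafOf-leaf  : ∀ a → Leaf tree (leafOf a)
    leaf-onto    : ∀ w → Leaf tree w → ∃[ a ] leafOf a ≡ w

-- Event labels: • speciation, □ duplication, ⊙ leaf
data Event : Set where
  spec dupl leafE : Event

-- Gene tree data (T, t, σ) with species set B = Fin m.
-- σ is given as a total map on vertices; only its values on leaves matter.
record GeneTree (m : ℕ) : Set where
  field
    tree   : RootedTree
    phylo  : IsPhylogenetic tree
  open RootedTree tree
  field
    t      : Fin size → Event
    σ      : Fin size → Fin m
    t-leaf : ∀ x → (t x ≡ leafE → Leaf tree x) × (Leaf tree x → t x ≡ leafE)

module _ {m : ℕ} (G : GeneTree m) where
  open GeneTree G
  open RootedTree tree

  σ-onto : Set
  σ-onto = ∀ b → ∃[ x ] (Leaf tree x × σ x ≡ b)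

  AtLeast3Leaves : Set
  AtLeast3Leaves = ∃[ x ] ∃[ y ] ∃[ z ]
    (Leaf tree x × Leaf tree y × Leaf tree z × x ≢ y × x ≢ z × y ≢ z)

  CondC : Set
  CondC = ∀ z → t z ≡ spec → ∀ c₁ c₂ → Child tree z c₁ → Child tree z c₂ →
          c₁ ≢ c₂ → ∀ x y → Leaf tree x → Leaf tree y →
          _⪯_ tree x c₁ → _⪯_ tree y c₂ → σ x ≢ σ y

  InG : Fin size → Fin size → Fin size → Set
  InG x y z = Displays tree x y z ×
    (∀ w → IsLCA tree (λ a → a ≡ x ⊎ a ≡ y ⊎ a ≡ z) w → t w ≡ spec) ×
    σ x ≢ σ y × σ x ≢ σ z × σ y ≢ σ z

  module _ (S : SpeciesTree m) where
    module S = SpeciesTree S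
    open RootedTree S.tree using () renaming (size to sizeS)

    DisplaysAllSpeciesTriples : Set
    DisplaysAllSpeciesTriples = ∀ x y z → InG x y z →
      Displays S.tree (S.leafOf (σ x)) (S.leafOf (σ y)) (S.leafOf (σ z))

    IsReconciliation : (Fin size → Pos S.tree) → Set
    IsReconciliation μ =
      (∀ x → t x ≡ leafE → μ x ≡ vtx (S.leafOf (σ x))) ×
      (∀ x → t x ≡ spec → ∃[ w ] (μ x ≡ vtx w × ¬ Leaf S.tree w)) ×
      (∀ x → t x ≡ dupl → ∃[ v ] (μ x ≡ edg v × v ≢ RootedTree.root S.tree)) ×
      (∀ x y → _≺_ tree x y →
         (t x ≡ dupl → t y ≡ dupl → _⪯ᴾ_ S.tree (μ x) (μ y)) ×
         (¬ (t x ≡ dupl × t y ≡ dupl) → _≺ᴾ_ S.tree (μ x) (μ y))) ×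
      (∀ x → t x ≡ spec → ∃[ w ] (μ x ≡ vtx w ×
         IsLCA S.tree (λ s → ∃[ y ] (Leaf tree y × _⪯_ tree y x × s ≡ S.leafOf (σ y))) w))

-- A speciation or duplication vertex x is sent to u = lca_S(σ(L(x))) (a duplication to the edge
-- above u) and a leaf to its species.  The root edge [ρ_S, lca_S(B)] keeps u away from ρ_S, and
-- condition (C) makes u an inner vertex when x is a speciation.  The real content is strict descent
-- below a speciation vertex y: suppose a child c of y has lca_S(σ(L(c))) = u as well.  Take leaves a
-- below c and z below another child, and let d be the child of u above σ(a).  For a leaf b below c
-- with σ(b) ≠ σ(a), condition (C) puts ((a,b),z) in 𝔊(T,t,σ), so S displays ((σa,σb),σz); hence
-- lca_S(σa,σb) lies strictly below u, and therefore below d.  So σ(L(c)) lies below d ≺ u,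
-- contradicting lca_S(σ(L(c))) = u.
module Submission where

open import Defs
open import Data.Nat using (ℕ; zero; suc; _+_; _*_; _∸_; _≤_; _<_; _≤?_; s≤s; anyUpTo?)
open import Data.Nat.Properties using (≰⇒>; *-comm; +-comm; m∸n+n≡m; ≤-total; ≮⇒≥; <⇒≱; n<1+n)
open import Data.Nat.Induction using (<-rec)
open import Data.Fin using (Fin) renaming (_≟_ to _≟ᶠ_)
open import Data.Fin.Properties using (any?; all?)
open import Data.List using (filter; allFin)
open import Data.List.Extrema.Nat using (argmax; argmax-all; f[xs]≤f[argmax])
open import Data.List.Membership.Propositional.Properties using (∈-filter⁺; ∈-allFin)
open import Data.List.Relation.Unary.All using (lookup)
open import Data.List.Relation.Unary.All.Properties using (all-filter)
open import Data.Product using (∃; ∃₂; ∃-syntax; _×_; _,_; proj₁; proj₂)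
open import Data.Sum using (_⊎_; inj₁; inj₂)
open import Data.Empty using (⊥; ⊥-elim)
open import Function using (_∘_)
open import Relation.Nullary using (¬_; Dec; yes; no)
open import Relation.Nullary.Decidable using (_×-dec_; _→-dec_; ¬?; map′; decidable-stable)
open import Relation.Unary using (Decidable)
open import Relation.Binary.PropositionalEquality

iter-+ : ∀ {A : Set} (f : A → A) m n x → iter f (m + n) x ≡ iter f m (iter f n x)
iter-+ f zero    n x = refl
iter-+ f (suc m) n x = cong f (iter-+ f m n x)

iter-suc : ∀ {A : Set} (f : A → A) k x → iter f (suc k) x ≡ iter f k (f x)
iter-suc f zero    x = refl
iter-suc f (suc k) x = cong f (iter-suc f k x)

iter-fix : ∀ {A : Set} (f : A → A) {x} → f x ≡ x → ∀ k → iter f k x ≡ x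
iter-fix f fx≡x zero    = refl
iter-fix f fx≡x (suc k) = trans (cong f (iter-fix f fx≡x k)) fx≡x

iter-periodic : ∀ {A : Set} (f : A → A) {n x} → iter f n x ≡ x → ∀ r → iter f (r * n) x ≡ x
iter-periodic f         p zero    = refl
iter-periodic f {n} {x} p (suc r) =
  trans (iter-+ f n (r * n) x) (trans (cong (iter f n) (iter-periodic f p r)) p)

least-witness : ∀ {P : ℕ → Set} → Decidable P → ∀ n → P n →
                ∃ λ k → P k × (∀ {j} → j < k → ¬ P j)
least-witness {P} P? n = <-rec (λ n → P n → Least) search n
  where
  Least = ∃ λ k → P k × (∀ {j} → j < k → ¬ P j)
  search : ∀ n → (∀ {m} → m < n → P m → Least) → P n → Least
  search n smaller pn with anyUpTo? P? n
  ... | yes (m , m<n , pm) = smaller m<n pm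
  ... | no none            = n , pn , λ j<n pj → none (_ , j<n , pj)

module RootedTreeProperties (T : RootedTree) where
  open RootedTree T

  infix 4 _≼_
  _≼_ : Vtx T → Vtx T → Set
  _≼_ = _⪯_ T

  UpperBound : (Vtx T → Set) → Vtx T → Set
  UpperBound A w = ∀ a → A a → a ≼ w

  ≼-refl : ∀ {x} → x ≼ x
  ≼-refl = 0 , refl

  ≼-trans : ∀ {x y z} → x ≼ y → y ≼ z → x ≼ z
  ≼-trans {x} (i , p) (j , q) = j + i , trans (iter-+ parent j i x) (trans (cong (iter parent j) p) q)

  ≼-root : ∀ x → x ≼ root
  ≼-root = reach

  iter-root : ∀ k → iter parent k root ≡ root
  iter-root = iter-fix parent parent-root

  root-≼ : ∀ {y} → root ≼ y → y ≡ root
  root-≼ (k , p) = trans (sym p) (iter-root k)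

  periodic⇒root : ∀ {x} n → iter parent (suc n) x ≡ x → x ≡ root
  periodic⇒root {x} n cycle = begin
    x                                ≡⟨ sym (iter-periodic parent cycle K) ⟩
    iter parent (K * suc n) x        ≡⟨ cong (λ k → iter parent k x) (trans (*-comm K (suc n)) (+-comm K (n * K))) ⟩
    iter parent (n * K + K) x        ≡⟨ iter-+ parent (n * K) K x ⟩
    iter parent (n * K) (iter parent K x) ≡⟨ cong (iter parent (n * K)) x↝root ⟩
    iter parent (n * K) root         ≡⟨ iter-root (n * K) ⟩
    root                             ∎
    where
    open ≡-Reasoning
    K = proj₁ (reach x)
    x↝root = proj₂ (reach x)

  ≼-antisym : ∀ {x y} → x ≼ y → y ≼ x → x ≡ y
  ≼-antisym (zero  , p) _       = p
  ≼-antisym {x} {y} (suc i , p) (j , q) = begin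
    x                 ≡⟨ sym q ⟩
    iter parent j y   ≡⟨ cong (iter parent j) y≡root ⟩
    iter parent j root ≡⟨ iter-root j ⟩
    root              ≡⟨ sym y≡root ⟩
    y                 ∎
    where
    open ≡-Reasoning
    y≡root : y ≡ root
    y≡root = periodic⇒root (i + j)
      (trans (iter-+ parent (suc i) j y) (trans (cong (iter parent (suc i)) q) p))

  iterates-≼ : ∀ {i j x a b} → i ≤ j → iter parent i x ≡ a → iter parent j x ≡ b → a ≼ b
  iterates-≼ {i} {j} {x} i≤j refl q =
    j ∸ i , trans (sym (iter-+ parent (j ∸ i) i x)) (trans (cong (λ k → iter parent k x) (m∸n+n≡m i≤j)) q)

  ≼-total-above : ∀ {x a b} → x ≼ a → x ≼ b → a ≼ b ⊎ b ≼ a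
  ≼-total-above (i , p) (j , q) with ≤-total i j
  ... | inj₁ i≤j = inj₁ (iterates-≼ i≤j p q)
  ... | inj₂ j≤i = inj₂ (iterates-≼ j≤i q p)

  _≼?_ : ∀ x y → Dec (x ≼ y)
  x ≼? y = map′ (λ (k , _ , p) → k , p) shorten (anyUpTo? (λ k → iter parent k x ≟ᶠ y) (suc K))
    where
    K = proj₁ (reach x)
    x↝root = proj₂ (reach x)
    shorten : x ≼ y → ∃ λ k → k < suc K × iter parent k x ≡ y
    shorten (k , p) with ≤-total k K
    ... | inj₁ k≤K = k , s≤s k≤K , p
    ... | inj₂ K≤k = K , n<1+n K , trans x↝root (sym (root-≼ (iterates-≼ K≤k x↝root p)))

  ≼-parent : ∀ {x y} → x ≼ y → x ≢ y → parent x ≼ y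
  ≼-parent (zero  , p) x≢y = ⊥-elim (x≢y p)
  ≼-parent {x} (suc k , p) _ = k , trans (sym (iter-suc parent k x)) p

  child-≼ : ∀ {y c} → Child T y c → c ≼ y
  child-≼ (_ , p) = 1 , p

  child-≢ : ∀ {y c} → Child T y c → c ≢ y
  child-≢ (c≢root , p) refl = c≢root (periodic⇒root 0 p)

  child? : ∀ y c → Dec (Child T y c)
  child? y c = ¬? (c ≟ᶠ root) ×-dec (parent c ≟ᶠ y)

  leaf? : ∀ v → Dec (Leaf T v)
  leaf? v = all? (λ c → ¬? (child? v c))

  child-below : ∀ {s u} → s ≼ u → s ≢ u → ∃ λ d → Child T u d × s ≼ d
  child-below {s} {u} (k , p) s≢u = go k p
    where
    go : ∀ k → iter parent k s ≡ u → ∃ λ d → Child T u d × s ≼ d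
    go zero    p = ⊥-elim (s≢u p)
    go (suc k) p with iter parent k s ≟ᶠ u
    ... | yes q   = go k q
    ... | no  d≢u = iter parent k s , (d≢root , p) , (k , refl)
      where
      d≢root : iter parent k s ≢ root
      d≢root d≡root = d≢u (trans d≡root (trans (sym parent-root) (trans (cong parent (sym d≡root)) p)))

  leaf-≼ : ∀ {x w} → Leaf T w → x ≼ w → x ≡ w
  leaf-≼ {x} {w} w-leaf x≼w = decidable-stable (x ≟ᶠ w) λ x≢w →
    let (d , d-child , _) = child-below x≼w x≢w in w-leaf d d-child

  child-cut : ∀ {y c x w} → Child T y c → x ≼ c → x ≼ w → w ≼ c ⊎ y ≼ w
  child-cut {c = c} {w = w} c-child x≼c x≼w with ≼-total-above x≼w x≼c
  ... | inj₁ w≼c = inj₁ w≼c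
  ... | inj₂ c≼w with c ≟ᶠ w
  ...   | yes refl = inj₁ ≼-refl
  ...   | no  c≢w  = inj₂ (subst (_≼ w) (proj₂ c-child) (≼-parent c≼w c≢w))

  ≼-child-on-path : ∀ {u d s x} → Child T u d → s ≼ d → s ≼ x → x ≼ u → x ≢ u → x ≼ d
  ≼-child-on-path d-child s≼d s≼x x≼u x≢u with child-cut d-child s≼d s≼x
  ... | inj₁ x≼d = x≼d
  ... | inj₂ u≼x = ⊥-elim (x≢u (≼-antisym x≼u u≼x))

  ≼-only-child : ∀ {u r s} → Child T u r → (∀ c → Child T u c → c ≡ r) → s ≼ u → s ≢ u → s ≼ r
  ≼-only-child _ only s≼u s≢u =
    let (d , d-child , s≼d) = child-below s≼u s≢u in subst (_ ≼_) (only d d-child) s≼d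

  siblings-disjoint : ∀ {y c c′ z} → Child T y c → Child T y c′ → c ≢ c′ → z ≼ c → z ≼ c′ → ⊥
  siblings-disjoint c-child c′-child c≢c′ z≼c z≼c′
    with child-cut c-child z≼c z≼c′ | child-cut c′-child z≼c′ z≼c
  ... | inj₂ y≼c′ | _         = child-≢ c′-child (≼-antisym (child-≼ c′-child) y≼c′)
  ... | _         | inj₂ y≼c  = child-≢ c-child (≼-antisym (child-≼ c-child) y≼c)
  ... | inj₁ c′≼c | inj₁ c≼c′ = c≢c′ (≼-antisym c≼c′ c′≼c)

  lca-exists : (A : Vtx T → Set) → (∀ w → Dec (UpperBound A w)) → ∀ {a} → A a → ∃ (IsLCA T A)
  lca-exists A bound? {a} a∈A = lowest (least-witness (bound? ∘ ancestor) K root-bound)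
    where
    ancestor : ℕ → Vtx T
    ancestor k = iter parent k a
    K = proj₁ (reach a)
    root-bound : UpperBound A (ancestor K)
    root-bound = subst (UpperBound A) (sym (proj₂ (reach a))) (λ b _ → ≼-root b)
    lowest : (∃ λ k → UpperBound A (ancestor k) × (∀ {j} → j < k → ¬ UpperBound A (ancestor j))) →
             ∃ (IsLCA T A)
    lowest (k , k-bound , below-k-unbounded) = ancestor k , k-bound , least
      where
      least : ∀ w → UpperBound A w → ancestor k ≼ w
      least w w-bound with w-bound a a∈A
      ... | j , p with k ≤? j
      ...   | yes k≤j = iterates-≼ k≤j refl p
      ...   | no  k≰j = ⊥-elim (below-k-unbounded (≰⇒> k≰j) (subst (UpperBound A) (sym p) w-bound))

  lca-unique : ∀ {A w₁ w₂} → IsLCA T A w₁ → IsLCA T A w₂ → w₁ ≡ w₂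
  lca-unique (bound₁ , least₁) (bound₂ , least₂) = ≼-antisym (least₁ _ bound₂) (least₂ _ bound₁)

  lca-pair : ∀ x y → ∃ (IsLCA T (λ a → a ≡ x ⊎ a ≡ y))
  lca-pair x y = lca-exists _ bound? (inj₁ refl)
    where
    bound? : ∀ w → Dec (UpperBound (λ a → a ≡ x ⊎ a ≡ y) w)
    bound? w = map′ (λ { (x≼w , y≼w) _ (inj₁ refl) → x≼w ; (x≼w , y≼w) _ (inj₂ refl) → y≼w })
                    (λ bound → bound x (inj₁ refl) , bound y (inj₂ refl))
                    (x ≼? w ×-dec y ≼? w)

  two-children : ∀ v → ¬ Leaf T v → ¬ ExactlyOneChild T v →
                 ∃₂ λ c c′ → Child T v c × Child T v c′ × c ≢ c′
  two-children v not-leaf not-one with any? (child? v)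
  ... | no  none = ⊥-elim (not-leaf λ c c-child → none (c , c-child))
  ... | yes (c , c-child) with any? (λ c′ → child? v c′ ×-dec ¬? (c′ ≟ᶠ c))
  ...   | yes (c′ , c′-child , c′≢c) = c , c′ , c-child , c′-child , c′≢c ∘ sym
  ...   | no  none = ⊥-elim (not-one (c , c-child , λ c′ c′-child →
                       decidable-stable (c′ ≟ᶠ c) λ c′≢c → none (c′ , c′-child , c′≢c)))

  private
    distanceToRoot : ∀ x → ∃ λ k → iter parent k x ≡ root × (∀ {j} → j < k → iter parent j x ≢ root)
    distanceToRoot x = least-witness (λ k → iter parent k x ≟ᶠ root) (proj₁ (reach x)) (proj₂ (reach x))

  depth : Vtx T → ℕ
  depth x = proj₁ (distanceToRoot x)

  depth-child : ∀ {x c} → Child T x c → depth x < depth c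
  depth-child {x} {c} (c≢root , p) with distanceToRoot c
  ... | zero  , c≡root , _ = ⊥-elim (c≢root c≡root)
  ... | suc k , p′     , _ = s≤s (≮⇒≥ λ k<depth → proj₂ (proj₂ (distanceToRoot x)) k<depth x↝root)
    where
    x↝root : iter parent k x ≡ root
    x↝root = trans (cong (iter parent k) (sym p)) (trans (sym (iter-suc parent k c)) p′)

  leaf-below : ∀ v → ∃ λ l → Leaf T l × l ≼ v
  leaf-below v = deepest , deepest-leaf , deepest≼v
    where
    below-v = filter (_≼? v) (allFin size)
    deepest = argmax depth v below-v
    deepest≼v : deepest ≼ v
    deepest≼v = argmax-all depth ≼-refl (all-filter (_≼? v) (allFin size))
    deepest-leaf : Leaf T deepest
    deepest-leaf c c-child = <⇒≱ (depth-child c-child)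
      (lookup (f[xs]≤f[argmax] v below-v)
              (∈-filter⁺ (_≼? v) (∈-allFin c) (≼-trans (child-≼ c-child) deepest≼v)))

  displays⇒pair-below : ∀ {x y z w} → Displays T x y z → x ≼ w → y ≼ w → z ≼ w →
                        ∃ λ u → x ≼ u × y ≼ u × u ≼ w × u ≢ w
  displays⇒pair-below {x} {y} {z} {w}
    (_ , _ , _ , _ , _ , _ , u , v , (u-bound , _) , (_ , v-least) , u≼v , u≢v) x≼w y≼w z≼w =
    u , u-bound x (inj₁ refl) , u-bound y (inj₂ refl) , ≼-trans u≼v v≼w ,
    λ { refl → u≢v (≼-antisym u≼v v≼w) }
    where
    v≼w : v ≼ w
    v≼w = v-least w λ { _ (inj₁ refl) → x≼w ; _ (inj₂ (inj₁ refl)) → y≼w ; _ (inj₂ (inj₂ refl)) → z≼w }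

module _ {m : ℕ} (G : GeneTree m) (S : SpeciesTree m) where
  open GeneTree G using (t; σ; t-leaf; phylo)
  open SpeciesTree S using (leafOf; leafOf-inj; leafOf-leaf; rootOneChild)
  private
    TG = GeneTree.tree G
    TS = SpeciesTree.tree S
    module TG = RootedTreeProperties TG
    module TS = RootedTreeProperties TS
  open TG using () renaming (_≼_ to _≼ᴳ_)
  open TS using () renaming (_≼_ to _≼ˢ_)

  species : Vtx TG → Vtx TS
  species y = leafOf (σ y)

  σL : Vtx TG → Vtx TS → Set
  σL x s = ∃[ y ] (Leaf TG y × y ≼ᴳ x × s ≡ species y)

  σL-bound? : ∀ x w → Dec (TS.UpperBound (σL x) w)
  σL-bound? x w = map′
    (λ bound → λ { s (y , y-leaf , y≼x , refl) → bound y (y-leaf , y≼x) })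
    (λ bound y (y-leaf , y≼x) → bound (species y) (y , y-leaf , y≼x , refl))
    (all? λ y → (TG.leaf? y ×-dec y TG.≼? x) →-dec (species y TS.≼? w))

  -- Opaque: letting the typechecker unfold the search behind the lca makes the lemmas below very slow.
  opaque
    lca-σL-exists : ∀ x → ∃ (IsLCA TS (σL x))
    lca-σL-exists x =
      let (l , l-leaf , l≼x) = TG.leaf-below x
      in TS.lca-exists (σL x) (σL-bound? x) (l , l-leaf , l≼x , refl)

  lcaσL : Vtx TG → Vtx TS
  lcaσL x = proj₁ (lca-σL-exists x)

  lcaσL-isLCA : ∀ x → IsLCA TS (σL x) (lcaσL x)
  lcaσL-isLCA x = proj₂ (lca-σL-exists x)

  species-≼-lcaσL : ∀ {y x} → Leaf TG y → y ≼ᴳ x → species y ≼ˢ lcaσL x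
  species-≼-lcaσL y-leaf y≼x = proj₁ (lcaσL-isLCA _) _ (_ , y-leaf , y≼x , refl)

  lcaσL-mono : ∀ {x y} → x ≼ᴳ y → lcaσL x ≼ˢ lcaσL y
  lcaσL-mono x≼y = proj₂ (lcaσL-isLCA _) _ λ { _ (z , z-leaf , z≼x , refl) →
    species-≼-lcaσL z-leaf (TG.≼-trans z≼x x≼y) }

  lcaσL-≢-root : ∀ x → lcaσL x ≢ RootedTree.root TS
  lcaσL-≢-root x lca≡root =
    TS.child-≢ r-child (TS.≼-antisym (TS.child-≼ r-child) (subst (_≼ˢ r) lca≡root lca≼r))
    where
    r = proj₁ rootOneChild
    r-child = proj₁ (proj₂ rootOneChild)
    species-≢-root : ∀ y → species y ≢ RootedTree.root TS
    species-≢-root y s≡root = leafOf-leaf (σ y) r (subst (λ v → Child TS v r) (sym s≡root) r-child)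
    lca≼r : lcaσL x ≼ˢ r
    lca≼r = proj₂ (lcaσL-isLCA x) r λ { _ (y , _ , _ , refl) →
      TS.≼-only-child r-child (proj₂ (proj₂ rootOneChild)) (TS.≼-root (species y)) (species-≢-root y) }

  spec-not-leaf : ∀ {x} → t x ≡ spec → ¬ Leaf TG x
  spec-not-leaf {x} x-spec x-leaf with trans (sym x-spec) (proj₂ (t-leaf x) x-leaf)
  ... | ()

  spec-children : ∀ {x} → t x ≡ spec → ∃₂ λ c c′ → Child TG x c × Child TG x c′ × c ≢ c′
  spec-children {x} x-spec = TG.two-children x (spec-not-leaf x-spec) (phylo x)

  spec-other-child : ∀ {x c} → t x ≡ spec → Child TG x c → ∃ λ c′ → Child TG x c′ × c ≢ c′
  spec-other-child {c = c} x-spec _ with spec-children x-spec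
  ... | c₁ , c₂ , c₁-child , c₂-child , c₁≢c₂ with c ≟ᶠ c₁
  ...   | yes refl = c₂ , c₂-child , c₁≢c₂
  ...   | no  c≢c₁ = c₁ , c₁-child , c≢c₁

  module _ (condC : CondC G) where

    lcaσL-spec-not-leaf : ∀ {x} → t x ≡ spec → ¬ Leaf TS (lcaσL x)
    lcaσL-spec-not-leaf {x} x-spec lca-leaf =
      let (c₁ , c₂ , c₁-child , c₂-child , c₁≢c₂) = spec-children x-spec
          (l₁ , l₁-leaf , l₁≼c₁) = TG.leaf-below c₁
          (l₂ , l₂-leaf , l₂≼c₂) = TG.leaf-below c₂
      in condC x x-spec c₁ c₂ c₁-child c₂-child c₁≢c₂ l₁ l₂ l₁-leaf l₂-leaf l₁≼c₁ l₂≼c₂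
           (leafOf-inj (σ l₁) (σ l₂)
             (trans (at-lca l₁-leaf l₁≼c₁ c₁-child) (sym (at-lca l₂-leaf l₂≼c₂ c₂-child))))
      where
      at-lca : ∀ {l c} → Leaf TG l → l ≼ᴳ c → Child TG x c → species l ≡ lcaσL x
      at-lca l-leaf l≼c c-child =
        TS.leaf-≼ lca-leaf (species-≼-lcaσL l-leaf (TG.≼-trans l≼c (TG.child-≼ c-child)))

    module _ (displaysAll : DisplaysAllSpeciesTriples G S) where

      module _ {y c c′} (y-spec : t y ≡ spec) (c-child : Child TG y c) (c′-child : Child TG y c′)
               (c≢c′ : c ≢ c′) where

        spec-triple∈𝔊 : ∀ {a b z} → Leaf TG a → Leaf TG b → Leaf TG z → a ≼ᴳ c → b ≼ᴳ c → z ≼ᴳ c′ →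
                        σ a ≢ σ b → InG G a b z
        spec-triple∈𝔊 {a} {b} {z} a-leaf b-leaf z-leaf a≼c b≼c z≼c′ σa≢σb =
          ( a-leaf , b-leaf , z-leaf , σa≢σb ∘ cong σ , σa≢σz ∘ cong σ , σb≢σz ∘ cong σ
          , u , y , u-lca , y-lca , TG.≼-trans u≼c (TG.child-≼ c-child) , u≢y )
          , (λ w w-lca → subst (λ v → t v ≡ spec) (TG.lca-unique y-lca w-lca) y-spec)
          , σa≢σb , σa≢σz , σb≢σz
          where
          σa≢σz = condC y y-spec c c′ c-child c′-child c≢c′ a z a-leaf z-leaf a≼c z≼c′
          σb≢σz = condC y y-spec c c′ c-child c′-child c≢c′ b z b-leaf z-leaf b≼c z≼c′
          u = proj₁ (TG.lca-pair a b)
          u-lca = proj₂ (TG.lca-pair a b)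
          u≼c : u ≼ᴳ c
          u≼c = proj₂ u-lca c λ { _ (inj₁ refl) → a≼c ; _ (inj₂ refl) → b≼c }
          u≢y : u ≢ y
          u≢y refl = TG.child-≢ c-child (TG.≼-antisym (TG.child-≼ c-child) u≼c)
          y-lca : IsLCA TG (λ q → q ≡ a ⊎ q ≡ b ⊎ q ≡ z) y
          y-lca = (λ { _ (inj₁ refl) → TG.≼-trans a≼c (TG.child-≼ c-child)
                     ; _ (inj₂ (inj₁ refl)) → TG.≼-trans b≼c (TG.child-≼ c-child)
                     ; _ (inj₂ (inj₂ refl)) → TG.≼-trans z≼c′ (TG.child-≼ c′-child) })
                , least
            where
            least : ∀ w → TG.UpperBound (λ q → q ≡ a ⊎ q ≡ b ⊎ q ≡ z) w → y ≼ᴳ w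
            least w w-bound with TG.child-cut c-child a≼c (w-bound a (inj₁ refl))
            ... | inj₁ w≼c = ⊥-elim (TG.siblings-disjoint c-child c′-child c≢c′
                                       (TG.≼-trans (w-bound z (inj₂ (inj₂ refl))) w≼c) z≼c′)
            ... | inj₂ y≼w = y≼w

        species-below-child : ∀ {a z d b} → Leaf TG a → a ≼ᴳ c → Leaf TG z → z ≼ᴳ c′ →
                              Child TS (lcaσL y) d → species a ≼ˢ d → Leaf TG b → b ≼ᴳ c → species b ≼ˢ d
        species-below-child {a} {z} {d} {b} a-leaf a≼c z-leaf z≼c′ d-child a≼d b-leaf b≼c
          with σ b ≟ᶠ σ a
        ... | yes σb≡σa = subst (λ q → leafOf q ≼ˢ d) (sym σb≡σa) a≼d
        ... | no  σb≢σa =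
          let abz∈𝔊 = spec-triple∈𝔊 a-leaf b-leaf z-leaf a≼c b≼c z≼c′ (σb≢σa ∘ sym)
              (u , a≼u , b≼u , u≼lca , u≢lca) =
                TS.displays⇒pair-below (displaysAll a b z abz∈𝔊)
                  (species-≼-lcaσL a-leaf (TG.≼-trans a≼c (TG.child-≼ c-child)))
                  (species-≼-lcaσL b-leaf (TG.≼-trans b≼c (TG.child-≼ c-child)))
                  (species-≼-lcaσL z-leaf (TG.≼-trans z≼c′ (TG.child-≼ c′-child)))
          in TS.≼-trans b≼u (TS.≼-child-on-path d-child a≼d a≼u u≼lca u≢lca)

      lcaσL-child-≢ : ∀ {y c} → t y ≡ spec → Child TG y c → lcaσL c ≢ lcaσL y
      lcaσL-child-≢ {y} {c} y-spec c-child lca-c≡lca-y =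
        let (c′ , c′-child , c≢c′) = spec-other-child y-spec c-child
            (a , a-leaf , a≼c) = TG.leaf-below c
            (z , z-leaf , z≼c′) = TG.leaf-below c′
            (d , d-child , a≼d) =
              TS.child-below (species-≼-lcaσL a-leaf (TG.≼-trans a≼c (TG.child-≼ c-child)))
                λ a≡lca → lcaσL-spec-not-leaf y-spec (subst (Leaf TS) a≡lca (leafOf-leaf (σ a)))
            lca-c≼d = proj₂ (lcaσL-isLCA c) d λ { _ (b , b-leaf , b≼c , refl) →
              species-below-child y-spec c-child c′-child c≢c′
                a-leaf a≼c z-leaf z≼c′ d-child a≼d b-leaf b≼c }
        in TS.child-≢ d-child (TS.≼-antisym (TS.child-≼ d-child) (subst (_≼ˢ d) lca-c≡lca-y lca-c≼d))

      lcaσL-strict : ∀ {x y} → t y ≡ spec → x ≼ᴳ y → x ≢ y → lcaσL x ≼ˢ lcaσL y × lcaσL x ≢ lcaσL y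
      lcaσL-strict y-spec x≼y x≢y =
        let (d , d-child , x≼d) = TG.child-below x≼y x≢y
        in lcaσL-mono x≼y , λ lca-x≡lca-y → lcaσL-child-≢ y-spec d-child
             (TS.≼-antisym (lcaσL-mono (TG.child-≼ d-child))
                           (subst (_≼ˢ lcaσL d) lca-x≡lca-y (lcaσL-mono x≼d)))

      position : Event → Vtx TG → Pos TS
      position spec  x = vtx (lcaσL x)
      position dupl  x = edg (lcaσL x)
      position leafE x = vtx (species x)

      μ : Vtx TG → Pos TS
      μ x = position (t x) x

      μ-leaf : ∀ x → t x ≡ leafE → μ x ≡ vtx (species x)
      μ-leaf x x-leaf rewrite x-leaf = refl

      μ-spec : ∀ x → t x ≡ spec → ∃[ w ] (μ x ≡ vtx w × ¬ Leaf TS w)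
      μ-spec x x-spec rewrite x-spec = lcaσL x , refl , lcaσL-spec-not-leaf x-spec

      μ-dupl : ∀ x → t x ≡ dupl → ∃[ v ] (μ x ≡ edg v × v ≢ RootedTree.root TS)
      μ-dupl x x-dupl rewrite x-dupl = lcaσL x , refl , lcaσL-≢-root x

      μ-spec-lca : ∀ x → t x ≡ spec → ∃[ w ] (μ x ≡ vtx w × IsLCA TS (σL x) w)
      μ-spec-lca x x-spec rewrite x-spec = lcaσL x , refl , lcaσL-isLCA x

      μ-order : ∀ x y → _≺_ TG x y →
                (t x ≡ dupl → t y ≡ dupl → _⪯ᴾ_ TS (μ x) (μ y)) ×
                (¬ (t x ≡ dupl × t y ≡ dupl) → _≺ᴾ_ TS (μ x) (μ y))
      μ-order x y (x≼y , x≢y) with t x in x-event | t y in y-event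
      ... | _     | leafE = ⊥-elim (x≢y (TG.leaf-≼ (proj₁ (t-leaf y) y-event) x≼y))
      ... | leafE | spec  = (λ ()) , λ _ → species-≼-lcaσL (proj₁ (t-leaf x) x-event) x≼y ,
                            λ x≡lca → lcaσL-spec-not-leaf y-event (subst (Leaf TS) x≡lca (leafOf-leaf (σ x)))
      ... | leafE | dupl  = (λ ()) , λ _ → species-≼-lcaσL (proj₁ (t-leaf x) x-event) x≼y
      ... | spec  | spec  = (λ ()) , λ _ → lcaσL-strict y-event x≼y x≢y
      ... | spec  | dupl  = (λ ()) , λ _ → lcaσL-mono x≼y
      ... | dupl  | spec  = (λ _ ()) , λ _ →
                              let (lca≼ , lca≢) = lcaσL-strict y-event x≼y x≢y in TS.≼-parent lca≼ lca≢
      ... | dupl  | dupl  = (λ _ _ → lcaσL-mono x≼y) , λ not-both → ⊥-elim (not-both (refl , refl))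

      μ-isReconciliation : IsReconciliation G S μ
      μ-isReconciliation = μ-leaf , μ-spec , μ-dupl , μ-order , μ-spec-lca

theorem1 : (m : ℕ) (G : GeneTree m) (S : SpeciesTree m) →
    σ-onto G → AtLeast3Leaves G → CondC G →
    DisplaysAllSpeciesTriples G S →
    ∃[ μ ] IsReconciliation G S μ
theorem1 m G S _ _ condC displaysAll =
  μ G S condC displaysAll , μ-isReconciliation G S condC displaysAll
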